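{- Let $V$ be a finite nonempty set and $f$ an and-net on $V$. (1) Every subnetwork of $f$ has a unique fixed point if and only if every chordless cycle of $G(f)$ has a delocalizing vertex in $G(f)$. (2) Every subnetwork of $f$ has at most one fixed point if and only if every chordless positive cycle of $G(f)$ has a delocalizing vertex in $G(f)$.
   Context: $\mathbb{B}=\{0,1\}$. A network on $V$ is $f:\mathbb{B}^V\to\mathbb{B}^V$. With $x^{j\alpha}$ denoting $x$ with $j$-component set to $\alpha$, $f_{ij}(x)=f_i(x^{j1})-f_i(x^{j0})$; $G(f)$ is the signed digraph on $V$ with a positive arc $j\to i$ if $f_{ij}(x)=1$ for some $x$ and a negative arc $j\to i$ if $f_{ij}(x)=-1$ for some $x$; it is simple if it has at most one arc from any vertex to any vertex. $f$ is an and-net if $G(f)$ is simple and for every $i$ and $x$: $f_i(x)=1$ iff there is no positive arc $j\to i$ with $x_j=0$ and no negative arc $j\to i$ with $x_j=1$. For nonempty $I\subseteq V$ and $z\in\mathbb{B}^{V\setminus I}$, the subnetwork induced by $z$ is the network $h$ on $I$ with $h(x|_I)=f(x)|_I$ for all $x$ whose restriction to $V\setminus I$ is $z$; $f$ is a subnetwork of itself. A cycle of $G(f)$ is a subgraph whose underlying unsigned digraph is a directed cycle (loops count); it is positive if it has an even number of negative arcs; it is chordless if its underlying unsigned digraph is an induced subgraph of the underlying unsigned digraph of $G(f)$. A delocalizing vertex of a cycle $C$ is a vertex $v$ (possibly of $C$) such that $G(f)$ has a positive arc from $v$ to some vertex of $C$ and a negative arc from $v$ to a different vertex of $C$. -}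

module Defs where

open import Data.Bool using (Bool; true; false; if_then_else_)
open import Data.Nat using (ℕ; zero; suc; _+_; _%_)
open import Data.Fin using (Fin; toℕ; _≟_) renaming (zero to fzero; suc to fsuc)
open import Data.Product using (Σ; ∃; _×_; _,_)
open import Data.Sum using (_⊎_)
open import Relation.Nullary using (¬_; does)
open import Relation.Binary.PropositionalEquality using (_≡_; _≢_)
open import Function.Bundles using (_⇔_)

Config : ℕ → Set
Config n = Fin n → Bool

Net : ℕ → Set
Net n = Config n → Config n

upd : ∀ {n} → Config n → Fin n → Bool → Config n
upd x j α k = if does (k ≟ j) then α else x k

PosArc : ∀ {n} → Net n → Fin n → Fin n → Set
PosArc f j i = ∃ λ x → (f (upd x j false) i ≡ false) × (f (upd x j true) i ≡ true)

NegArc : ∀ {n} → Net n → Fin n → Fin n → Set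
NegArc f j i = ∃ λ x → (f (upd x j false) i ≡ true) × (f (upd x j true) i ≡ false)

Arc : ∀ {n} → Net n → Fin n → Fin n → Set
Arc f j i = PosArc f j i ⊎ NegArc f j i

Simple : ∀ {n} → Net n → Set
Simple f = ∀ j i → ¬ (PosArc f j i × NegArc f j i)

AndNet : ∀ {n} → Net n → Set
AndNet {n} f = Simple f × (∀ i x → (f x i ≡ true) ⇔
  ((∀ j → PosArc f j i → x j ≡ true) × (∀ j → NegArc f j i → x j ≡ false)))

-- Subnetwork induced by z ∈ B^{V∖I}, with I given as a characteristic function.
-- (The values of z on I are irrelevant.)  A fixed point y ∈ B^I of the subnetwork
-- corresponds exactly to the configuration x ∈ B^V with x|_{V∖I} = z and x|_I = y,
-- and y is fixed iff f(x)_i = x_i for every i ∈ I.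
SubFixed : ∀ {n} → Net n → (I : Fin n → Bool) → Config n → Config n → Set
SubFixed f I z x = (∀ j → I j ≡ false → x j ≡ z j) × (∀ i → I i ≡ true → f x i ≡ x i)

SameOnI : ∀ {n} → (I : Fin n → Bool) → Config n → Config n → Set
SameOnI I x y = ∀ i → I i ≡ true → x i ≡ y i

NonemptySubset : ∀ {n} → (Fin n → Bool) → Set
NonemptySubset I = ∃ λ i → I i ≡ true

SubAtMostOne : ∀ {n} → Net n → (I : Fin n → Bool) → Config n → Set
SubAtMostOne f I z = ∀ x y → SubFixed f I z x → SubFixed f I z y → SameOnI I x y

SubUnique : ∀ {n} → Net n → (I : Fin n → Bool) → Config n → Set
SubUnique f I z = (∃ λ x → SubFixed f I z x) × SubAtMostOne f I z

EverySubUnique : ∀ {n} → Net n → Set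
EverySubUnique f = ∀ I → NonemptySubset I → ∀ z → SubUnique f I z

EverySubAtMostOne : ∀ {n} → Net n → Set
EverySubAtMostOne f = ∀ I → NonemptySubset I → ∀ z → SubAtMostOne f I z

IsNext : ∀ {k} → Fin (suc k) → Fin (suc k) → Set
IsNext {k} s t = toℕ t ≡ suc (toℕ s) % suc k

countTrue : ∀ {m} → (Fin m → Bool) → ℕ
countTrue {zero} σ = 0
countTrue {suc m} σ = (if σ fzero then 1 else 0) + countTrue (λ t → σ (fsuc t))

record Cycle {n} (f : Net n) : Set where
  field
    k      : ℕ
    c      : Fin (suc k) → Fin n
    c-inj  : ∀ s t → c s ≡ c t → s ≡ t
    neg    : Fin (suc k) → Bool
    arcNeg : ∀ s t → IsNext s t → neg s ≡ true → NegArc f (c s) (c t)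
    arcPos : ∀ s t → IsNext s t → neg s ≡ false → PosArc f (c s) (c t)

open Cycle public

PositiveCycle : ∀ {n} {f : Net n} → Cycle f → Set
PositiveCycle C = countTrue (neg C) % 2 ≡ 0

Chordless : ∀ {n} {f : Net n} → Cycle f → Set
Chordless {f = f} C = ∀ s t → Arc f (c C s) (c C t) → IsNext s t

Delocalizing : ∀ {n} {f : Net n} → Cycle f → Fin n → Set
Delocalizing {f = f} C v = ∃ λ s → ∃ λ t →
  (c C s ≢ c C t) × PosArc f v (c C s) × NegArc f v (c C t)

HasDelocalizing : ∀ {n} {f : Net n} → Cycle f → Set
HasDelocalizing C = ∃ λ v → Delocalizing C v

-- If a chordless cycle C has no delocalizing vertex, every vertex outside C can be frozen to a
-- value satisfying all of its arcs into C.  In the resulting subnetwork on C each vertex copies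
-- its predecessor on C, negated along negative arcs, so it has two fixed points when C is
-- positive and none when C is negative.
--
-- Conversely, take a subnetwork on a set I, minimal with two fixed points x and y (resp. with
-- no fixed point).  Minimality forces x and y to differ everywhere on I (resp. forces the fixed
-- points of the subnetworks on I ∖ {t} that take different values at t to differ everywhere
-- on I), and from this every vertex of I has exactly one in-neighbour in I.  Following
-- in-neighbours backwards gives a chordless cycle in I.  No vertex of I delocalizes it, as the
-- cycle's vertices have no in-neighbour in I besides their predecessor; no vertex outside I
-- does, as the frozen values satisfy every arc entering I.  With two fixed points the cycle is
-- moreover positive, since along every arc inside I the value of x is kept by positive arcs and
-- flipped by negative ones.

module Submission where

open import Defs
open import Data.Bool using (Bool; true; false; not; _∧_; _∨_; _xor_; if_then_else_)
import Data.Bool as Bool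
open import Data.Bool.Properties
  using (¬-not; not-¬; not-involutive; not-injective; xor-assoc; xor-comm; xor-same; xor-identityʳ;
         not-distribˡ-xor; not-distribʳ-xor; xor-annihilates-not; ∧-zeroʳ; ∨-zeroʳ)
open import Data.Nat using (ℕ; zero; suc; _+_; _∸_; _%_; _≤_; _<_; z≤n; s≤s; s≤s⁻¹)
open import Data.Nat.Properties
  using (_<?_; +-comm; ≮⇒≥; ∸-cancelˡ-≡; m∸n≤m; +-∸-assoc; n∸n≡0; m∸n+n≡m; m<n⇒0<n∸m; m≤m+n;
         +-monoʳ-<; ≤-trans; <-trans; <-irrefl; n≤1+n; n<1+n; <-cmp; <⇒≤)
open import Data.Nat.DivMod using (m%n<n; m<n⇒m%n≡m; n%n≡0; [m+n]%n≡m%n)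
open import Data.Nat.Induction using (<-wellFounded)
open import Data.Nat.GeneralisedArithmetic using (fold; fold-+)
open import Data.Fin using (Fin; toℕ; fromℕ; fromℕ<; inject₁) renaming (zero to fzero; suc to fsuc)
import Data.Fin as Fin
import Data.Fin.Properties as Finₚ
open import Data.Fin.Properties
  using (toℕ<n; toℕ-injective; toℕ-fromℕ<; toℕ-fromℕ; toℕ-inject₁; any?; all?; pigeonhole)
open import Data.Fin.Subset.Properties using (anySubset?)
open import Data.Vec using (tabulate; lookup)
open import Data.Vec.Properties using (lookup∘tabulate)
open import Data.Product using (Σ; ∃; _×_; _,_; proj₁; proj₂)
open import Data.Sum using (_⊎_; inj₁; inj₂)
open import Data.Empty using (⊥; ⊥-elim)
open import Function using (_∘_)
open import Function.Bundles using (_⇔_; Equivalence; mk⇔)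
open import Induction.WellFounded using (module All)
open import Relation.Binary.Construct.On using (wellFounded)
open import Relation.Nullary using (¬_; Dec; yes; no; does)
import Relation.Nullary.Decidable as Dec
open import Relation.Nullary.Decidable using (dec-true; dec-false)
open import Relation.Binary.Definitions using (tri<; tri≈; tri>)
open import Relation.Binary.PropositionalEquality
  using (_≡_; _≢_; refl; sym; trans; cong; cong₂; subst; module ≡-Reasoning)

false≢true : false ≢ true
false≢true ()

dec-true⁻¹ : ∀ {A : Set} (a? : Dec A) → does a? ≡ true → A
dec-true⁻¹ (yes a) _ = a

dec-false⁻¹ : ∀ {A : Set} (a? : Dec A) → does a? ≡ false → ¬ A
dec-false⁻¹ (no ¬a) _ = ¬a

Subset : ℕ → Set
Subset = Config

_⊆_ : ∀ {m} → Subset m → Subset m → Set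
I ⊆ J = ∀ i → I i ≡ true → J i ≡ true

anyConfig? : ∀ {m} {P : Config m → Set} → (∀ x → Dec (P x)) →
             (∀ {x y} → (∀ i → x i ≡ y i) → P x → P y) → Dec (∃ P)
anyConfig? P? resp =
  Dec.map′ (λ (v , p) → lookup v , p)
           (λ (x , p) → tabulate x , resp (λ i → sym (lookup∘tabulate x i)) p)
           (anySubset? (P? ∘ lookup))

countTrue≤ : ∀ {m} (I : Subset m) → countTrue I ≤ m
countTrue≤ {zero} I = z≤n
countTrue≤ {suc m} I with I fzero
... | true = s≤s (countTrue≤ (I ∘ fsuc))
... | false = ≤-trans (countTrue≤ (I ∘ fsuc)) (n≤1+n m)

countTrue-mono : ∀ {m} {I J : Subset m} → I ⊆ J → countTrue I ≤ countTrue J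
countTrue-mono {zero} I⊆J = z≤n
countTrue-mono {suc m} {I} {J} I⊆J with I fzero in I0 | J fzero in J0
... | false | false = countTrue-mono (I⊆J ∘ fsuc)
... | false | true = ≤-trans (countTrue-mono (I⊆J ∘ fsuc)) (n≤1+n _)
... | true | true = s≤s (countTrue-mono (I⊆J ∘ fsuc))
... | true | false with () ← trans (sym (I⊆J fzero I0)) J0

countTrue-mono-< : ∀ {m} {I J : Subset m} → I ⊆ J → ∀ i → I i ≡ false → J i ≡ true →
                   countTrue I < countTrue J
countTrue-mono-< {I = I} {J} I⊆J fzero Ii Ji rewrite Ii | Ji = s≤s (countTrue-mono (I⊆J ∘ fsuc))
countTrue-mono-< {I = I} {J} I⊆J (fsuc i) Ii Ji with I fzero in I0 | J fzero in J0
... | false | false = countTrue-mono-< (I⊆J ∘ fsuc) i Ii Ji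
... | false | true = ≤-trans (countTrue-mono-< (I⊆J ∘ fsuc) i Ii Ji) (n≤1+n _)
... | true | true = s≤s (countTrue-mono-< (I⊆J ∘ fsuc) i Ii Ji)
... | true | false with () ← trans (sym (I⊆J fzero I0)) J0

subset-induction : ∀ {m ℓ} (P : Subset m → Set ℓ) →
                   (∀ I → (∀ J → countTrue J < countTrue I → P J) → P I) → ∀ I → P I
subset-induction P step = All.wfRec (wellFounded countTrue <-wellFounded) _ P
  (λ I rec → step I (λ J → rec {J}))

remove : ∀ {m} → Fin m → Subset m → Subset m
remove t I u = I u ∧ not (does (u Fin.≟ t))

module Remove {m} (t : Fin m) (I : Subset m) where

  remove-⊆ : remove t I ⊆ I
  remove-⊆ u u∈ with I u
  ... | true = refl

  remove-∈ : ∀ {u} → I u ≡ true → u ≢ t → remove t I u ≡ true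
  remove-∈ {u} u∈I u≢t = cong₂ (λ a b → a ∧ not b) u∈I (dec-false (u Fin.≟ t) u≢t)

  remove-∉ : ∀ {u} → remove t I u ≡ false → I u ≡ false ⊎ u ≡ t
  remove-∉ {u} u∉ with u Fin.≟ t | I u
  ... | yes u≡t | _ = inj₂ u≡t
  ... | no _ | false = inj₁ refl

  remove-self : remove t I t ≡ false
  remove-self = trans (cong (λ b → I t ∧ not b) (dec-true (t Fin.≟ t) refl)) (∧-zeroʳ (I t))

  remove-≢ : ∀ {u} → remove t I u ≡ true → u ≢ t
  remove-≢ u∈ refl = false≢true (trans (sym remove-self) u∈)

  remove-< : I t ≡ true → countTrue (remove t I) < countTrue I
  remove-< t∈I = countTrue-mono-< remove-⊆ t remove-self t∈I

module _ {m} (S : ℕ → Subset m) (inflationary : ∀ j → S j ⊆ S (suc j)) where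

  stabilises-or-grows : ∀ j → (∃ λ K → S (suc K) ⊆ S K) ⊎ j ≤ countTrue (S j)
  stabilises-or-grows zero = inj₂ z≤n
  stabilises-or-grows (suc j) with stabilises-or-grows j
  ... | inj₁ stable = inj₁ stable
  ... | inj₂ large with any? (λ u → (S (suc j) u Bool.≟ true) Dec.×-dec (S j u Bool.≟ false))
  ...   | yes (u , new , old) = inj₂ (≤-trans (s≤s large) (countTrue-mono-< (inflationary j) u old new))
  ...   | no no-new = inj₁ (j , λ u new → ¬-not (λ old → no-new (u , new , old)))

  inflationary-stabilises : ∃ λ K → S (suc K) ⊆ S K
  inflationary-stabilises with stabilises-or-grows (suc m)
  ... | inj₁ stable = stable
  ... | inj₂ large = ⊥-elim (<-irrefl refl (≤-trans large (countTrue≤ (S (suc m)))))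

firstTrue : (ℕ → Bool) → ℕ → ℕ
firstTrue P zero = 0
firstTrue P (suc n) = if P 0 then 0 else suc (firstTrue (P ∘ suc) n)

firstTrue-true : ∀ (P : ℕ → Bool) n → P n ≡ true → P (firstTrue P n) ≡ true
firstTrue-true P zero Pn = Pn
firstTrue-true P (suc n) Pn with P 0 in P0
... | true = P0
... | false = firstTrue-true (P ∘ suc) n Pn

firstTrue-least : ∀ (P : ℕ → Bool) n k → k < firstTrue P n → P k ≡ false
firstTrue-least P (suc n) k k< with P 0 in P0
firstTrue-least P (suc n) zero k< | false = P0
firstTrue-least P (suc n) (suc k) k< | false = firstTrue-least (P ∘ suc) n k (s≤s⁻¹ k<)

next : ∀ {k} → Fin (suc k) → Fin (suc k)
next {k} s = fromℕ< (m%n<n (suc (toℕ s)) (suc k))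

isNext-next : ∀ {k} (s : Fin (suc k)) → IsNext s (next s)
isNext-next {k} s = toℕ-fromℕ< (m%n<n (suc (toℕ s)) (suc k))

isNext⇒≡next : ∀ {k} {s t : Fin (suc k)} → IsNext s t → t ≡ next s
isNext⇒≡next {s = s} st = toℕ-injective (trans st (sym (isNext-next s)))

data InjectOrLast : ∀ {k} → Fin (suc k) → Set where
  inject : ∀ {k} (s : Fin k) → InjectOrLast (inject₁ s)
  last : ∀ {k} → InjectOrLast (fromℕ k)

injectOrLast : ∀ {k} (s : Fin (suc k)) → InjectOrLast s
injectOrLast {zero} fzero = last
injectOrLast {suc k} fzero = inject fzero
injectOrLast {suc k} (fsuc s) with injectOrLast s
... | inject s′ = inject (fsuc s′)
... | last = last

next-inject₁ : ∀ {k} (s : Fin k) → next (inject₁ s) ≡ fsuc s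
next-inject₁ {k} s = toℕ-injective (begin
  toℕ (next (inject₁ s))         ≡⟨ isNext-next (inject₁ s) ⟩
  suc (toℕ (inject₁ s)) % suc k  ≡⟨ cong (λ m → suc m % suc k) (toℕ-inject₁ s) ⟩
  suc (toℕ s) % suc k            ≡⟨ m<n⇒m%n≡m (s≤s (toℕ<n s)) ⟩
  suc (toℕ s)                    ∎)
  where open ≡-Reasoning

next-last : ∀ k → next (fromℕ k) ≡ fzero
next-last k = toℕ-injective (begin
  toℕ (next (fromℕ k))         ≡⟨ isNext-next (fromℕ k) ⟩
  suc (toℕ (fromℕ k)) % suc k  ≡⟨ cong (λ m → suc m % suc k) (toℕ-fromℕ k) ⟩
  suc k % suc k                ≡⟨ n%n≡0 (suc k) ⟩
  0                            ∎)
  where open ≡-Reasoning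

prev : ∀ {k} → Fin (suc k) → Fin (suc k)
prev {k} fzero = fromℕ k
prev {suc k} (fsuc t) = inject₁ t

next-prev : ∀ {k} (t : Fin (suc k)) → next (prev t) ≡ t
next-prev {k} fzero = next-last k
next-prev {suc k} (fsuc t) = next-inject₁ t

next-injective : ∀ {k} {s t : Fin (suc k)} → next s ≡ next t → s ≡ t
next-injective {k} {s} {t} eq with injectOrLast s | injectOrLast t
... | inject a | inject b =
  cong inject₁ (Finₚ.suc-injective (trans (sym (next-inject₁ a)) (trans eq (next-inject₁ b))))
... | inject a | last with () ← trans (sym (next-inject₁ a)) (trans eq (next-last _))
... | last | inject b with () ← trans (sym (next-inject₁ b)) (trans (sym eq) (next-last _))
... | last | last = refl

parity : ∀ {m} → (Fin m → Bool) → Bool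
parity {zero} σ = false
parity {suc m} σ = σ fzero xor parity (σ ∘ fsuc)

parity-cong : ∀ {m} {σ τ : Fin m → Bool} → (∀ i → σ i ≡ τ i) → parity σ ≡ parity τ
parity-cong {zero} eq = refl
parity-cong {suc m} eq = cong₂ _xor_ (eq fzero) (parity-cong (eq ∘ fsuc))

xor-interchange : ∀ a b c d → (a xor b) xor (c xor d) ≡ (a xor c) xor (b xor d)
xor-interchange false b false d = refl
xor-interchange false b true d = sym (not-distribʳ-xor b d)
xor-interchange true b false d = sym (not-distribˡ-xor b d)
xor-interchange true b true d = xor-annihilates-not b d

parity-xor : ∀ {m} (σ τ : Fin m → Bool) → parity (λ i → σ i xor τ i) ≡ parity σ xor parity τ
parity-xor {zero} σ τ = refl
parity-xor {suc m} σ τ = trans (cong ((σ fzero xor τ fzero) xor_) (parity-xor (σ ∘ fsuc) (τ ∘ fsuc)))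
  (xor-interchange (σ fzero) (τ fzero) (parity (σ ∘ fsuc)) (parity (τ ∘ fsuc)))

parity-snoc : ∀ {m} (σ : Fin (suc m) → Bool) → parity σ ≡ parity (σ ∘ inject₁) xor σ (fromℕ m)
parity-snoc {zero} σ = xor-identityʳ (σ fzero)
parity-snoc {suc m} σ = trans (cong (σ fzero xor_) (parity-snoc (σ ∘ fsuc))) (sym (xor-assoc (σ fzero) _ _))

parity-rotate : ∀ {k} (g : Fin (suc k) → Bool) → parity (g ∘ next) ≡ parity g
parity-rotate {k} g = begin
  parity (g ∘ next)                                   ≡⟨ parity-snoc (g ∘ next) ⟩
  parity (g ∘ next ∘ inject₁) xor g (next (fromℕ k))  ≡⟨ cong₂ _xor_ (parity-cong (cong g ∘ next-inject₁))
                                                                      (cong g (next-last k)) ⟩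
  parity (g ∘ fsuc) xor g fzero                       ≡⟨ xor-comm (parity (g ∘ fsuc)) (g fzero) ⟩
  parity g                                            ∎
  where open ≡-Reasoning

parity-around-cycle : ∀ {k} (g : Fin (suc k) → Bool) → parity (λ s → g s xor g (next s)) ≡ false
parity-around-cycle g = begin
  parity (λ s → g s xor g (next s)) ≡⟨ parity-xor g (g ∘ next) ⟩
  parity g xor parity (g ∘ next)    ≡⟨ cong (parity g xor_) (parity-rotate g) ⟩
  parity g xor parity g             ≡⟨ xor-same (parity g) ⟩
  false                             ∎
  where open ≡-Reasoning

prefixParity : ∀ {m} → (Fin (suc m) → Bool) → Fin (suc m) → Bool
prefixParity σ fzero = false
prefixParity {suc m} σ (fsuc s) = σ fzero xor prefixParity (σ ∘ fsuc) s

prefixParity-inject₁ : ∀ {m} (σ : Fin (suc m) → Bool) (s : Fin m) →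
                       prefixParity σ (fsuc s) ≡ prefixParity σ (inject₁ s) xor σ (inject₁ s)
prefixParity-inject₁ {suc m} σ fzero = xor-identityʳ (σ fzero)
prefixParity-inject₁ {suc m} σ (fsuc s) =
  trans (cong (σ fzero xor_) (prefixParity-inject₁ (σ ∘ fsuc) s)) (sym (xor-assoc (σ fzero) _ _))

prefixParity-last : ∀ {m} (σ : Fin (suc m) → Bool) → prefixParity σ (fromℕ m) xor σ (fromℕ m) ≡ parity σ
prefixParity-last {zero} σ = sym (xor-identityʳ (σ fzero))
prefixParity-last {suc m} σ = trans (xor-assoc (σ fzero) _ _) (cong (σ fzero xor_) (prefixParity-last (σ ∘ fsuc)))

prefixParity-next : ∀ {k} (σ : Fin (suc k) → Bool) → parity σ ≡ false →
                    ∀ s → prefixParity σ (next s) ≡ prefixParity σ s xor σ s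
prefixParity-next σ even s with injectOrLast s
... | inject s′ = trans (cong (prefixParity σ) (next-inject₁ s′)) (prefixParity-inject₁ σ s′)
... | last = trans (cong (prefixParity σ) (next-last _)) (sym (trans (prefixParity-last σ) even))

coboundary⇒even : ∀ {k} (σ g : Fin (suc k) → Bool) → (∀ s → g (next s) ≡ g s xor σ s) → parity σ ≡ false
coboundary⇒even σ g δg = trans (parity-cong σ≡δg) (parity-around-cycle g)
  where
  σ≡δg : ∀ s → σ s ≡ g s xor g (next s)
  σ≡δg s = sym (begin
    g s xor g (next s)      ≡⟨ cong (g s xor_) (δg s) ⟩
    g s xor (g s xor σ s)   ≡⟨ sym (xor-assoc (g s) (g s) (σ s)) ⟩
    (g s xor g s) xor σ s   ≡⟨ cong (_xor σ s) (xor-same (g s)) ⟩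
    σ s                     ∎)
    where open ≡-Reasoning

odd : ℕ → Bool
odd zero = false
odd (suc n) = not (odd n)

%2≡odd : ∀ n → n % 2 ≡ (if odd n then 1 else 0)
%2≡odd zero = refl
%2≡odd (suc zero) = refl
%2≡odd (suc (suc n)) = begin
  suc (suc n) % 2                        ≡⟨ cong (_% 2) (+-comm 2 n) ⟩
  (n + 2) % 2                            ≡⟨ [m+n]%n≡m%n n 2 ⟩
  n % 2                                  ≡⟨ %2≡odd n ⟩
  (if odd n then 1 else 0)               ≡⟨ cong (λ b → if b then 1 else 0) (sym (not-involutive (odd n))) ⟩
  (if odd (suc (suc n)) then 1 else 0)   ∎
  where open ≡-Reasoning

odd-countTrue : ∀ {m} (σ : Fin m → Bool) → odd (countTrue σ) ≡ parity σ
odd-countTrue {zero} σ = refl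
odd-countTrue {suc m} σ with σ fzero
... | true = cong not (odd-countTrue (σ ∘ fsuc))
... | false = odd-countTrue (σ ∘ fsuc)

even-countTrue⇔even-parity : ∀ {m} (σ : Fin m → Bool) → (countTrue σ % 2 ≡ 0) ⇔ (parity σ ≡ false)
even-countTrue⇔even-parity σ = mk⇔ to from
  where
  countTrue%2 : countTrue σ % 2 ≡ (if parity σ then 1 else 0)
  countTrue%2 = trans (%2≡odd (countTrue σ)) (cong (λ b → if b then 1 else 0) (odd-countTrue σ))
  to : countTrue σ % 2 ≡ 0 → parity σ ≡ false
  to even with parity σ | countTrue%2
  ... | false | _ = refl
  ... | true | one with () ← trans (sym one) even
  from : parity σ ≡ false → countTrue σ % 2 ≡ 0
  from even = trans countTrue%2 (cong (λ b → if b then 1 else 0) even)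

module SignedArcs {N : ℕ} (f : Net N) where

  isNegative : ∀ {j i} → Arc f j i → Bool
  isNegative (inj₁ _) = false
  isNegative (inj₂ _) = true

  negative-arc : ∀ {j i} (a : Arc f j i) → isNegative a ≡ true → NegArc f j i
  negative-arc (inj₂ q) _ = q
  negative-arc (inj₁ _) ()

  positive-arc : ∀ {j i} (a : Arc f j i) → isNegative a ≡ false → PosArc f j i
  positive-arc (inj₁ p) _ = p
  positive-arc (inj₂ _) ()

  literal : ∀ {j i} → Arc f j i → Bool → Bool
  literal (inj₁ _) b = b
  literal (inj₂ _) b = not b

  literal-not : ∀ {j i} (a : Arc f j i) b → literal a (not b) ≡ not (literal a b)
  literal-not (inj₁ _) b = refl
  literal-not (inj₂ _) b = refl

  isNegative-violates : ∀ {j i} (a : Arc f j i) → literal a (isNegative a) ≡ false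
  isNegative-violates (inj₁ _) = refl
  isNegative-violates (inj₂ _) = refl

upd-same : ∀ {n} (x : Config n) t b → upd x t b t ≡ b
upd-same x t b = cong (λ d → if d then b else x t) (dec-true (t Fin.≟ t) refl)

upd-other : ∀ {n} (x : Config n) t b {w} → w ≢ t → upd x t b w ≡ x w
upd-other x t b {w} w≢t = cong (λ d → if d then b else x w) (dec-false (w Fin.≟ t) w≢t)

upd-cong : ∀ {n} {x y : Config n} j b → (∀ k → x k ≡ y k) → ∀ k → upd x j b k ≡ upd y j b k
upd-cong j b x≗y k with does (k Fin.≟ j)
... | true = refl
... | false = x≗y k

module AndNetProperties {N : ℕ} {f : Net N} (andNet : AndNet f) where

  open SignedArcs f public

  simple : Simple f
  simple = proj₁ andNet

  module _ {x : Config N} {i : Fin N} where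

    true⇒pos-satisfied : f x i ≡ true → ∀ {j} → PosArc f j i → x j ≡ true
    true⇒pos-satisfied fx = proj₁ (Equivalence.to (proj₂ andNet i x) fx) _

    true⇒neg-satisfied : f x i ≡ true → ∀ {j} → NegArc f j i → x j ≡ false
    true⇒neg-satisfied fx = proj₂ (Equivalence.to (proj₂ andNet i x) fx) _

    satisfied⇒true : (∀ j → PosArc f j i → x j ≡ true) → (∀ j → NegArc f j i → x j ≡ false) → f x i ≡ true
    satisfied⇒true pos neg = Equivalence.from (proj₂ andNet i x) (pos , neg)

    pos-violated⇒false : ∀ {j} → PosArc f j i → x j ≡ false → f x i ≡ false
    pos-violated⇒false p xj with f x i in fx
    ... | false = refl
    ... | true with () ← trans (sym xj) (true⇒pos-satisfied fx p)

    neg-violated⇒false : ∀ {j} → NegArc f j i → x j ≡ true → f x i ≡ false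
    neg-violated⇒false p xj with f x i in fx
    ... | false = refl
    ... | true with () ← trans (sym xj) (true⇒neg-satisfied fx p)

  f-local : ∀ {x y i} → (∀ j → Arc f j i → x j ≡ y j) → f x i ≡ f y i
  f-local {x} {y} {i} x≗y with f x i in fx | f y i in fy
  ... | true | true = refl
  ... | false | false = refl
  ... | true | false with () ← trans (sym (satisfied⇒true
         (λ j p → trans (sym (x≗y j (inj₁ p))) (true⇒pos-satisfied fx p))
         (λ j p → trans (sym (x≗y j (inj₂ p))) (true⇒neg-satisfied fx p)))) fy
  ... | false | true with () ← trans (sym (satisfied⇒true
         (λ j p → trans (x≗y j (inj₁ p)) (true⇒pos-satisfied fy p))
         (λ j p → trans (x≗y j (inj₂ p)) (true⇒neg-satisfied fy p)))) fx

  f-cong : ∀ {x y i} → (∀ j → x j ≡ y j) → f x i ≡ f y i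
  f-cong x≗y = f-local (λ j _ → x≗y j)

  posArc? : ∀ j i → Dec (PosArc f j i)
  posArc? j i = anyConfig? (λ x → (f (upd x j false) i Bool.≟ false) Dec.×-dec (f (upd x j true) i Bool.≟ true))
    (λ x≗y (e₀ , e₁) → trans (sym (f-cong (upd-cong j false x≗y))) e₀ ,
                       trans (sym (f-cong (upd-cong j true x≗y))) e₁)

  negArc? : ∀ j i → Dec (NegArc f j i)
  negArc? j i = anyConfig? (λ x → (f (upd x j false) i Bool.≟ true) Dec.×-dec (f (upd x j true) i Bool.≟ false))
    (λ x≗y (e₀ , e₁) → trans (sym (f-cong (upd-cong j false x≗y))) e₀ ,
                       trans (sym (f-cong (upd-cong j true x≗y))) e₁)

  arc? : ∀ j i → Dec (Arc f j i)
  arc? j i = posArc? j i Dec.⊎-dec negArc? j i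

  differing-in-neighbour : ∀ {x y i} → f x i ≢ f y i → ∃ λ j → Arc f j i × x j ≢ y j
  differing-in-neighbour {x} {y} {i} fx≢fy with any? (λ j → arc? j i Dec.×-dec Dec.¬? (x j Bool.≟ y j))
  ... | yes found = found
  ... | no none = ⊥-elim (fx≢fy (f-local agree))
    where
    agree : ∀ j → Arc f j i → x j ≡ y j
    agree j a with x j Bool.≟ y j
    ... | yes eq = eq
    ... | no ne = ⊥-elim (none (j , a , ne))

  true⇒literal : ∀ {x j i} → f x i ≡ true → (a : Arc f j i) → literal a (x j) ≡ true
  true⇒literal fx (inj₁ p) = true⇒pos-satisfied fx p
  true⇒literal fx (inj₂ q) = cong not (true⇒neg-satisfied fx q)

  literal-false⇒false : ∀ {x j i} (a : Arc f j i) → literal a (x j) ≡ false → f x i ≡ false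
  literal-false⇒false (inj₁ p) lit = pos-violated⇒false p lit
  literal-false⇒false {x} {j} (inj₂ q) lit = neg-violated⇒false q (trans (sym (not-involutive (x j))) (cong not lit))

  literal-unique : ∀ {j i} (a a′ : Arc f j i) b → literal a′ b ≡ literal a b
  literal-unique (inj₁ _) (inj₁ _) b = refl
  literal-unique (inj₂ _) (inj₂ _) b = refl
  literal-unique (inj₁ p) (inj₂ q) b = ⊥-elim (simple _ _ (p , q))
  literal-unique (inj₂ q) (inj₁ p) b = ⊥-elim (simple _ _ (p , q))

  literals⇒true : ∀ {x i} → (∀ j (a : Arc f j i) → literal a (x j) ≡ true) → f x i ≡ true
  literals⇒true sat = satisfied⇒true (λ j p → sat j (inj₁ p)) (λ j q → not-injective (sat j (inj₂ q)))

  sole-input : ∀ {x j i} (a : Arc f j i) → (∀ j′ (a′ : Arc f j′ i) → j′ ≢ j → literal a′ (x j′) ≡ true) →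
               f x i ≡ literal a (x j)
  sole-input {x} {j} {i} a others with literal a (x j) in lit
  ... | false = literal-false⇒false a lit
  ... | true = literals⇒true satisfied
    where
    satisfied : ∀ j′ (a′ : Arc f j′ i) → literal a′ (x j′) ≡ true
    satisfied j′ a′ with j′ Fin.≟ j
    ... | no j′≢j = others j′ a′ j′≢j
    ... | yes refl = trans (literal-unique a a′ (x j)) lit

  fixed-point? : ∀ I z → Dec (∃ (SubFixed f I z))
  fixed-point? I z = anyConfig?
    (λ x → all? (λ j → (I j Bool.≟ false) Dec.→-dec (x j Bool.≟ z j))
           Dec.×-dec all? (λ i → (I i Bool.≟ true) Dec.→-dec (f x i Bool.≟ x i)))
    (λ x≗y (off , on) → (λ j j∉I → trans (sym (x≗y j)) (off j j∉I)) ,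
                        (λ i i∈I → trans (sym (f-cong x≗y)) (trans (on i i∈I) (x≗y i))))

  true-mixture : ∀ {a b m i} → f a i ≡ true → f b i ≡ true → (∀ j → m j ≡ a j ⊎ m j ≡ b j) →
                 f m i ≡ true
  true-mixture {a} {b} {m} fa fb m∈ = literals⇒true satisfied
    where
    satisfied : ∀ j (arc : Arc f j _) → literal arc (m j) ≡ true
    satisfied j arc with m∈ j
    ... | inj₁ mj≡aj = subst (λ v → literal arc v ≡ true) (sym mj≡aj) (true⇒literal fa arc)
    ... | inj₂ mj≡bj = subst (λ v → literal arc v ≡ true) (sym mj≡bj) (true⇒literal fb arc)

module Orbit {N : ℕ} (π : Fin N → Fin N) where

  iter : ℕ → Fin N → Fin N
  iter m v = fold v π m

  iter-+ : ∀ m n v → iter (m + n) v ≡ iter m (iter n v)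
  iter-+ m n v = fold-+ v π m

  record Periodic (u : Fin N) : Set where
    field
      period-1 : ℕ
      returns : iter (suc period-1) u ≡ u
      minimal : ∀ e → 0 < e → e ≤ period-1 → iter e u ≢ u

  abstract
    eventually-periodic : ∀ v → ∃ λ i → Periodic (iter i v)
    eventually-periodic v with pigeonhole (n<1+n N) (λ (i : Fin (suc N)) → iter (toℕ i) v)
    ... | i , j , i<j , iᵥ≡jᵥ = toℕ i , periodic (firstTrue Returns d) (firstTrue-true Returns d Returns-d)
                                            (firstTrue-least Returns d)
      where
      u : Fin N
      u = iter (toℕ i) v
      d : ℕ
      d = toℕ j ∸ toℕ i
      returns? : ∀ e → Dec (0 < e × iter e u ≡ u)
      returns? e = (0 <? e) Dec.×-dec (iter e u Fin.≟ u)
      Returns : ℕ → Bool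
      Returns e = does (returns? e)
      Returns-d : Returns d ≡ true
      Returns-d = dec-true (returns? d) (m<n⇒0<n∸m i<j ,
        trans (sym (iter-+ d (toℕ i) v)) (trans (cong (λ m → iter m v) (m∸n+n≡m (<⇒≤ i<j))) (sym iᵥ≡jᵥ)))
      periodic : ∀ e → Returns e ≡ true → (∀ e′ → e′ < e → Returns e′ ≡ false) → Periodic u
      periodic e ret least with dec-true⁻¹ (returns? e) ret
      ... | s≤s _ , back = record
        { period-1 = _ ; returns = back
        ; minimal = λ e′ 0<e′ e′≤ back′ →
            dec-false⁻¹ (returns? e′) (least e′ (s≤s e′≤)) (0<e′ , back′) }

  module _ {u : Fin N} (periodic : Periodic u) where
    open Periodic periodic

    iter-injective< : ∀ {a b} → a < b → b ≤ period-1 → iter a u ≢ iter b u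
    iter-injective< {a} {b} a<b b≤ aᵤ≡bᵤ = minimal (rest + a) 0<e (s≤s⁻¹ e<period) back
      where
      rest : ℕ
      rest = suc period-1 ∸ b
      rest+b≡period : rest + b ≡ suc period-1
      rest+b≡period = m∸n+n≡m (≤-trans b≤ (n≤1+n period-1))
      0<e : 0 < rest + a
      0<e = ≤-trans (m<n⇒0<n∸m (s≤s b≤)) (m≤m+n rest a)
      e<period : rest + a < suc period-1
      e<period = subst (rest + a <_) rest+b≡period (+-monoʳ-< rest a<b)
      back : iter (rest + a) u ≡ u
      back = begin
        iter (rest + a) u       ≡⟨ iter-+ rest a u ⟩
        iter rest (iter a u)    ≡⟨ cong (iter rest) aᵤ≡bᵤ ⟩
        iter rest (iter b u)    ≡⟨ sym (iter-+ rest b u) ⟩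
        iter (rest + b) u       ≡⟨ cong (λ m → iter m u) rest+b≡period ⟩
        iter (suc period-1) u   ≡⟨ returns ⟩
        u                       ∎
        where open ≡-Reasoning

    iter-injective : ∀ {a b} → a ≤ period-1 → b ≤ period-1 → iter a u ≡ iter b u → a ≡ b
    iter-injective {a} {b} a≤ b≤ eq with <-cmp a b
    ... | tri< a<b _ _ = ⊥-elim (iter-injective< a<b b≤ eq)
    ... | tri≈ _ a≡b _ = a≡b
    ... | tri> _ _ b<a = ⊥-elim (iter-injective< b<a a≤ (sym eq))

module PredecessorCycle {N : ℕ} {f : Net N} (I : Subset N)
  (predecessor : ∀ v → I v ≡ true → ∃ λ u → I u ≡ true × Arc f u v)
  (predecessor-unique : ∀ {v a b} → I v ≡ true → I a ≡ true → I b ≡ true → Arc f a v → Arc f b v → a ≡ b)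
  {u₀ : Fin N} (u₀∈I : I u₀ ≡ true) where

  π : Fin N → Fin N
  π v with I v Bool.≟ true
  ... | yes v∈I = proj₁ (predecessor v v∈I)
  ... | no _ = v

  π-spec : ∀ v → I v ≡ true → I (π v) ≡ true × Arc f (π v) v
  π-spec v v∈I with I v Bool.≟ true
  ... | yes v∈I′ = proj₂ (predecessor v v∈I′)
  ... | no v∉I = ⊥-elim (v∉I v∈I)

  arc⇒≡π : ∀ {u v} → I v ≡ true → I u ≡ true → Arc f u v → u ≡ π v
  arc⇒≡π v∈I u∈I a = predecessor-unique v∈I u∈I (proj₁ (π-spec _ v∈I)) a (proj₂ (π-spec _ v∈I))

  open Orbit π
  open SignedArcs f

  iter-∈I : ∀ m {v} → I v ≡ true → I (iter m v) ≡ true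
  iter-∈I zero v∈I = v∈I
  iter-∈I (suc m) v∈I = proj₁ (π-spec _ (iter-∈I m v∈I))

  u : Fin N
  u = iter (proj₁ (eventually-periodic u₀)) u₀

  open Periodic (proj₂ (eventually-periodic u₀))

  -- The periodic part of the orbit of u₀ under π, listed in the direction of the arcs.
  vertex : Fin (suc period-1) → Fin N
  vertex s = iter (period-1 ∸ toℕ s) u

  vertex∈I : ∀ s → I (vertex s) ≡ true
  vertex∈I s = iter-∈I (period-1 ∸ toℕ s) (iter-∈I (proj₁ (eventually-periodic u₀)) u₀∈I)

  vertex-injective : ∀ s t → vertex s ≡ vertex t → s ≡ t
  vertex-injective s t eq = toℕ-injective (∸-cancelˡ-≡ (toℕ≤ s) (toℕ≤ t)
    (iter-injective (proj₂ (eventually-periodic u₀)) (m∸n≤m period-1 (toℕ s)) (m∸n≤m period-1 (toℕ t))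
      eq))
    where
    toℕ≤ : ∀ (s : Fin (suc period-1)) → toℕ s ≤ period-1
    toℕ≤ s = s≤s⁻¹ (toℕ<n s)

  vertex≡π-next : ∀ s → vertex s ≡ π (vertex (next s))
  vertex≡π-next s with injectOrLast s
  ... | inject s′ rewrite next-inject₁ s′ | toℕ-inject₁ s′ =
    cong (λ m → iter m u) (+-∸-assoc 1 {period-1} {suc (toℕ s′)} (toℕ<n s′))
  ... | last rewrite next-last period-1 | toℕ-fromℕ period-1 | n∸n≡0 period-1 = sym returns

  π-vertex : ∀ t → π (vertex t) ≡ vertex (prev t)
  π-vertex t = sym (trans (vertex≡π-next (prev t)) (cong (π ∘ vertex) (next-prev t)))

  arc-of : ∀ s → Arc f (vertex s) (vertex (next s))
  arc-of s =
    subst (λ w → Arc f w (vertex (next s))) (sym (vertex≡π-next s)) (proj₂ (π-spec _ (vertex∈I (next s))))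

  cycle : Cycle f
  cycle = record
    { k = period-1 ; c = vertex ; c-inj = vertex-injective ; neg = isNegative ∘ arc-of
    ; arcNeg = λ s t s→t negative →
        subst (NegArc f (vertex s) ∘ vertex) (sym (isNext⇒≡next s→t)) (negative-arc (arc-of s) negative)
    ; arcPos = λ s t s→t positive →
        subst (PosArc f (vertex s) ∘ vertex) (sym (isNext⇒≡next s→t)) (positive-arc (arc-of s) positive) }

  arc⇒≡prev : ∀ {s t} → Arc f (vertex s) (vertex t) → s ≡ prev t
  arc⇒≡prev {s} {t} a = vertex-injective s (prev t)
    (trans (arc⇒≡π (vertex∈I t) (vertex∈I s) a) (π-vertex t))

  chordless : Chordless cycle
  chordless s t a = subst (IsNext s) (trans (cong next (arc⇒≡prev {s} {t} a)) (next-prev t)) (isNext-next s)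

  no-delocalizing-vertex-in-I : ∀ v → I v ≡ true → ¬ Delocalizing cycle v
  no-delocalizing-vertex-in-I v v∈I (s , t , cs≢ct , p , q) = cs≢ct (cong vertex s≡t)
    where
    v≡prev : ∀ {w} → Arc f v (vertex w) → v ≡ vertex (prev w)
    v≡prev {w} a = trans (arc⇒≡π (vertex∈I w) v∈I a) (π-vertex w)
    s≡t : s ≡ t
    s≡t = begin
      s                 ≡⟨ sym (next-prev s) ⟩
      next (prev s)     ≡⟨ cong next (vertex-injective _ _
                             (trans (sym (v≡prev {s} (inj₁ p))) (v≡prev {t} (inj₂ q)))) ⟩
      next (prev t)     ≡⟨ next-prev t ⟩
      t                 ∎
      where open ≡-Reasoning

  no-delocalizing-vertex : (z : Config N) →
    (∀ {v w} → I v ≡ false → I w ≡ true → (a : Arc f v w) → literal a (z v) ≡ true) → ¬ HasDelocalizing cycle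
  no-delocalizing-vertex z satisfied (v , s , t , cs≢ct , p , q) with I v in v∈I
  ... | true = no-delocalizing-vertex-in-I v v∈I (s , t , cs≢ct , p , q)
  ... | false = false≢true (trans (sym (cong not (satisfied v∈I (vertex∈I s) (inj₁ p))))
                                  (satisfied v∈I (vertex∈I t) (inj₂ q)))

module CycleArcs {N : ℕ} {f : Net N} (andNet : AndNet f) (C : Cycle f) where
  open AndNetProperties andNet

  cycle-arc : ∀ s → Σ (Arc f (c C s) (c C (next s))) λ a → ∀ b → literal a b ≡ b xor neg C s
  cycle-arc s with neg C s in sign
  ... | false = inj₁ (arcPos C s (next s) (isNext-next s) sign) , λ b → sym (xor-identityʳ b)
  ... | true = inj₂ (arcNeg C s (next s) (isNext-next s) sign) , λ b → xor-comm true b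

  consistent⇒even : (x : Config N) →
    (∀ s (a : Arc f (c C s) (c C (next s))) → literal a (x (c C s)) ≡ x (c C (next s))) → parity (neg C) ≡ false
  consistent⇒even x consistent = coboundary⇒even (neg C) (x ∘ c C)
    (λ s → trans (sym (consistent s (proj₁ (cycle-arc s)))) (proj₂ (cycle-arc s) (x (c C s))))

module ChordlessCycleWithoutDelocalizingVertex {N : ℕ} {f : Net N} (andNet : AndNet f) (C : Cycle f)
  (chordless : Chordless C) (no-delocalizing : ¬ HasDelocalizing C) where
  open AndNetProperties andNet
  open CycleArcs andNet C

  on-cycle? : ∀ v → Dec (∃ λ s → c C s ≡ v)
  on-cycle? v = any? (λ s → c C s Fin.≟ v)

  support : Subset N
  support v = does (on-cycle? v)

  support-nonempty : NonemptySubset support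
  support-nonempty = c C fzero , dec-true (on-cycle? _) (fzero , refl)

  boundary : Config N
  boundary v = does (any? (λ s → posArc? v (c C s)))

  boundary-satisfies : ∀ {v s} (a : Arc f v (c C s)) → literal a (boundary v) ≡ true
  boundary-satisfies {v} (inj₁ p) = dec-true (any? (λ s → posArc? v (c C s))) (_ , p)
  boundary-satisfies {v} {t} (inj₂ q) = cong not (dec-false (any? (λ s → posArc? v (c C s))) no-pos)
    where
    no-pos : ¬ ∃ λ s → PosArc f v (c C s)
    no-pos (s , p) with c C s Fin.≟ c C t
    ... | yes cs≡ct = simple v (c C t) (subst (PosArc f v) cs≡ct p , q)
    ... | no cs≢ct = no-delocalizing (v , s , t , cs≢ct , p , q)

  extend : (Fin (suc (k C)) → Bool) → Config N
  extend g v with on-cycle? v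
  ... | yes (s , _) = g s
  ... | no _ = boundary v

  extend-vertex : ∀ g s → extend g (c C s) ≡ g s
  extend-vertex g s with on-cycle? (c C s)
  ... | yes (s′ , cs′≡cs) = cong g (c-inj C s′ s cs′≡cs)
  ... | no off = ⊥-elim (off (s , refl))

  extend-off : ∀ g v → support v ≡ false → extend g v ≡ boundary v
  extend-off g v off with on-cycle? v
  ... | no _ = refl
  ... | yes on = ⊥-elim (false≢true (trans (sym off) (dec-true (on-cycle? v) on)))

  cycle-dynamics : ∀ h → (∀ v → support v ≡ false → h v ≡ boundary v) →
                   ∀ s → f h (c C (next s)) ≡ h (c C s) xor neg C s
  cycle-dynamics h h-off s =
    trans (sole-input (proj₁ (cycle-arc s)) others) (proj₂ (cycle-arc s) (h (c C s)))
    where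
    others : ∀ j (a : Arc f j (c C (next s))) → j ≢ c C s → literal a (h j) ≡ true
    others j a j≢cs with on-cycle? j in j-on
    ... | yes (s′ , refl) =
      ⊥-elim (j≢cs (cong (c C) (next-injective (sym (isNext⇒≡next (chordless s′ (next s) a))))))
    ... | no _ = subst (λ b → literal a b ≡ true) (sym (h-off j (cong does j-on))) (boundary-satisfies a)

  fixed⇒consistent : ∀ {x} → SubFixed f support boundary x →
                     ∀ s → x (c C (next s)) ≡ x (c C s) xor neg C s
  fixed⇒consistent (x-off , x-fixed) s =
    trans (sym (x-fixed _ (dec-true (on-cycle? _) (next s , refl)))) (cycle-dynamics _ x-off s)

  odd⇒no-fixed-point : parity (neg C) ≡ true → ¬ ∃ (SubFixed f support boundary)
  odd⇒no-fixed-point odd-parity (x , fixed)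
    with () ← trans (sym odd-parity) (coboundary⇒even (neg C) (x ∘ c C) (fixed⇒consistent fixed))

  even⇒two-fixed-points : parity (neg C) ≡ false → ¬ SubAtMostOne f support boundary
  even⇒two-fixed-points even at-most-one = false≢true (begin
    false                 ≡⟨ sym (extend-vertex (potential false) fzero) ⟩
    x false (c C fzero)   ≡⟨ at-most-one (x false) (x true) (fixed false) (fixed true) _ (proj₂ support-nonempty) ⟩
    x true (c C fzero)    ≡⟨ extend-vertex (potential true) fzero ⟩
    true                  ∎)
    where
    open ≡-Reasoning
    potential : Bool → Fin (suc (k C)) → Bool
    potential b s = b xor prefixParity (neg C) s
    x : Bool → Config N
    x b = extend (potential b)
    potential-next : ∀ b s → potential b (next s) ≡ potential b s xor neg C s
    potential-next b s = trans (cong (b xor_) (prefixParity-next (neg C) even s)) (sym (xor-assoc b _ _))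
    fixed : ∀ b → SubFixed f support boundary (x b)
    fixed b = extend-off (potential b) , on-support
      where
      on-support : ∀ i → support i ≡ true → f (x b) i ≡ x b i
      on-support i on with dec-true⁻¹ (on-cycle? i) on
      ... | t , refl = subst (λ t′ → f (x b) (c C t′) ≡ x b (c C t′)) (next-prev t) (begin
        f (x b) (c C (next (prev t)))            ≡⟨ cycle-dynamics (x b) (extend-off (potential b)) (prev t) ⟩
        x b (c C (prev t)) xor neg C (prev t)    ≡⟨ cong (_xor neg C (prev t)) (extend-vertex (potential b) (prev t)) ⟩
        potential b (prev t) xor neg C (prev t)  ≡⟨ sym (potential-next b (prev t)) ⟩
        potential b (next (prev t))              ≡⟨ sym (extend-vertex (potential b) (next (prev t))) ⟩
        x b (c C (next (prev t)))                ∎)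

  not-unique : ¬ SubUnique f support boundary
  not-unique (exists , at-most-one) with parity (neg C) in sign
  ... | true = odd⇒no-fixed-point sign exists
  ... | false = even⇒two-fixed-points sign at-most-one

module Rankings {N : ℕ} (I : Subset N) (R : Fin N → Fin N → Set) where

  Ranking : Config N → Fin N → (Fin N → ℕ) → Set
  Ranking x t r = ∀ w → I w ≡ true → w ≢ t →
    (x w ≡ false → ∃ λ u → I u ≡ true × R u w × r u < r w) ×
    (x w ≡ true → ∀ u → I u ≡ true → R u w → r u < r w)

  module _ {x y : Config N} (complementary : ∀ w → I w ≡ true → y w ≡ not (x w))
           {v a b : Fin N} (v∈I : I v ≡ true) (xv : x v ≡ false) (a∈I : I a ≡ true) (av : R a v)
           {r r′ : Fin N → ℕ} (rank : Ranking x v r) (rank′ : Ranking y b r′) where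

    descend : ∀ w → I w ≡ true → w ≢ v → w ≢ b → ∃ λ u → I u ≡ true × r u < r w × r′ u < r′ w
    descend w w∈I w≢v w≢b with x w in xw
    ... | false = let (u , u∈I , uw , ru<) = proj₁ (rank w w∈I w≢v) xw
                  in u , u∈I , ru< , proj₂ (rank′ w w∈I w≢b) (trans (complementary w w∈I) (cong not xw)) u u∈I uw
    ... | true = let (u , u∈I , uw , r′u<) = proj₁ (rank′ w w∈I w≢b) (trans (complementary w w∈I) (cong not xw))
                 in u , u∈I , proj₂ (rank w w∈I w≢v) xw u u∈I uw , r′u<

    -- Descending along in-neighbours on which both r and r′ drop, one ends at b or at v,
    -- and a is r′-below v.
    Reaches : Fin N → Set
    Reaches w = I w ≡ true → w ≡ b ⊎ r b < r w ⊎ r′ a < r′ w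

    reaches : ∀ w → Reaches w
    reaches = All.wfRec (wellFounded r′ <-wellFounded) _ Reaches step
      where
      step : ∀ w → (∀ {u} → r′ u < r′ w → Reaches u) → Reaches w
      step w rec w∈I with w Fin.≟ b | w Fin.≟ v
      ... | yes w≡b | _ = inj₁ w≡b
      ... | no w≢b | yes refl =
        inj₂ (inj₂ (proj₂ (rank′ w w∈I w≢b) (trans (complementary w v∈I) (cong not xv)) a a∈I av))
      ... | no w≢b | no w≢v with descend w w∈I w≢v w≢b
      ... | u , u∈I , ru< , r′u< with rec r′u< u∈I
      ...   | inj₁ refl = inj₂ (inj₁ ru<)
      ...   | inj₂ (inj₁ rb<) = inj₂ (inj₁ (<-trans rb< ru<))
      ...   | inj₂ (inj₂ r′a<) = inj₂ (inj₂ (<-trans r′a< r′u<))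

    ranked-below : a ≢ b → a ≢ v → r b < r a
    ranked-below a≢b a≢v with descend a a∈I a≢v a≢b
    ... | u , u∈I , ru< , r′u< with reaches u u∈I
    ...   | inj₁ refl = ru<
    ...   | inj₂ (inj₁ rb<) = <-trans rb< ru<
    ...   | inj₂ (inj₂ r′a<) = ⊥-elim (<-irrefl refl (<-trans r′a< r′u<))

  unique-predecessor : ∀ {x y} → (∀ w → I w ≡ true → y w ≡ not (x w)) →
    ∀ {v a b} → I v ≡ true → x v ≡ false → I a ≡ true → I b ≡ true → R a v → R b v →
    ∀ {r ra rb} → Ranking x v r → Ranking y a ra → Ranking y b rb → a ≡ b
  unique-predecessor {x} complementary {v} {a} {b} v∈I xv a∈I b∈I av bv rank rank-a rank-b with a Fin.≟ b
  ... | yes a≡b = a≡b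
  ... | no a≢b with a Fin.≟ v | b Fin.≟ v
  ... | yes refl | _ =
    ⊥-elim (<-irrefl refl (proj₂ (rank-b a v∈I a≢b) (trans (complementary a v∈I) (cong not xv)) a v∈I av))
  ... | no _ | yes refl =
    ⊥-elim (<-irrefl refl (proj₂ (rank-a b v∈I (a≢b ∘ sym)) (trans (complementary b v∈I) (cong not xv)) b v∈I bv))
  ... | no a≢v | no b≢v = ⊥-elim (<-irrefl refl (<-trans
        (ranked-below complementary v∈I xv a∈I av rank rank-b a≢b a≢v)
        (ranked-below complementary v∈I xv b∈I bv rank rank-a (a≢b ∘ sym) b≢v)))

module MixedRanking {N : ℕ} {f : Net N} (andNet : AndNet f) {I : Subset N}
  (smaller-at-most-one : ∀ J → countTrue J < countTrue I → ∀ z → SubAtMostOne f J z)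
  {z x y : Config N} (x-fixed : SubFixed f I z x) (y-fixed : SubFixed f I z y)
  (complementary : ∀ w → I w ≡ true → y w ≡ not (x w)) where
  open AndNetProperties andNet
  open Rankings I (Arc f)

  agree-off : ∀ u → I u ≡ false → x u ≡ y u
  agree-off u u∉I = trans (proj₁ x-fixed u u∉I) (sym (proj₁ y-fixed u u∉I))

  x≢y : ∀ w → I w ≡ true → x w ≢ y w
  x≢y w w∈I xw≡yw = not-¬ refl (trans xw≡yw (complementary w w∈I))

  f-y≡not-x : ∀ w → I w ≡ true → f y w ≡ not (x w)
  f-y≡not-x w w∈I = trans (proj₂ y-fixed w w∈I) (complementary w w∈I)

  mix : Subset N → Config N
  mix S u = if S u then x u else y u

  mix-∈ : ∀ S {u} → S u ≡ true → mix S u ≡ x u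
  mix-∈ S {u} u∈S = cong (λ b → if b then x u else y u) u∈S

  mix-∉ : ∀ S {u} → S u ≡ false → mix S u ≡ y u
  mix-∉ S {u} u∉S = cong (λ b → if b then x u else y u) u∉S

  mix-off : ∀ S {u} → I u ≡ false → mix S u ≡ x u
  mix-off S {u} u∉I with S u
  ... | true = refl
  ... | false = sym (agree-off u u∉I)

  mix-monotone : ∀ {S T} → S ⊆ T → ∀ w → I w ≡ true → f (mix S) w ≡ x w → f (mix T) w ≡ x w
  mix-monotone {S} {T} S⊆T w w∈I fS≡x with x w in xw
  ... | true = true-mixture fS≡x (trans (proj₂ x-fixed w w∈I) xw) choice
    where
    choice : ∀ j → mix T j ≡ mix S j ⊎ mix T j ≡ x j
    choice j with T j in Tj | S j in Sj
    ... | true | _ = inj₂ refl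
    ... | false | false = inj₁ refl
    ... | false | true = ⊥-elim (false≢true (trans (sym Tj) (S⊆T j Sj)))
  ... | false with f (mix T) w in fT
  ...   | false = refl
  ...   | true =
    ⊥-elim (false≢true (trans (sym fS≡x) (true-mixture fT (trans (f-y≡not-x w w∈I) (cong not xw)) choice)))
    where
    choice : ∀ j → mix S j ≡ mix T j ⊎ mix S j ≡ y j
    choice j with S j in Sj
    ... | false = inj₂ refl
    ... | true = inj₁ (sym (mix-∈ T (S⊆T j Sj)))

  -- Starting from {t}, add the vertices w of I at which f (mix S) already agrees with x.  By
  -- minimality of I this reaches all of I, and the rank of a vertex is the step at which it enters.
  module Stages (t : Fin N) (t∈I : I t ≡ true) where
    open Remove t I

    grow : Subset N → Subset N
    grow S u = S u ∨ (I u ∧ does (f (mix S) u Bool.≟ x u))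

    grow-⊇ : ∀ S → S ⊆ grow S
    grow-⊇ S u u∈S = cong (_∨ (I u ∧ does (f (mix S) u Bool.≟ x u))) u∈S

    grow-∈ : ∀ S u → grow S u ≡ true → S u ≡ true ⊎ (I u ≡ true × f (mix S) u ≡ x u)
    grow-∈ S u u∈ with S u
    ... | true = inj₁ refl
    ... | false with I u | f (mix S) u Bool.≟ x u | u∈
    ...   | true | yes fS≡x | _ = inj₂ (refl , fS≡x)
    ...   | true | no _ | ()
    ...   | false | _ | ()

    stage : ℕ → Subset N
    stage zero u = does (u Fin.≟ t)
    stage (suc j) = grow (stage j)

    t∈stage : ∀ j → stage j t ≡ true
    t∈stage zero = dec-true (t Fin.≟ t) refl
    t∈stage (suc j) = grow-⊇ (stage j) t (t∈stage j)

    stage-sound : ∀ j u → stage j u ≡ true → u ≡ t ⊎ (I u ≡ true × f (mix (stage j)) u ≡ x u)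
    stage-sound zero u u∈ = inj₁ (dec-true⁻¹ (u Fin.≟ t) u∈)
    stage-sound (suc j) u u∈ with grow-∈ (stage j) u u∈
    ... | inj₂ (u∈I , fS≡x) = inj₂ (u∈I , mix-monotone (grow-⊇ (stage j)) u u∈I fS≡x)
    ... | inj₁ old with stage-sound j u old
    ...   | inj₁ u≡t = inj₁ u≡t
    ...   | inj₂ (u∈I , fS≡x) = inj₂ (u∈I , mix-monotone (grow-⊇ (stage j)) u u∈I fS≡x)

    abstract
      stabilisation : ∃ λ K → grow (stage K) ⊆ stage K
      stabilisation = inflationary-stabilises stage (grow-⊇ ∘ stage)

    K : ℕ
    K = proj₁ stabilisation

    stable : grow (stage K) ⊆ stage K
    stable = proj₂ stabilisation

    limit : Subset N
    limit = stage K

    x-fixed-off-t : SubFixed f (remove t I) (mix limit) x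
    x-fixed-off-t = off , λ u u∈ → proj₂ x-fixed u (remove-⊆ u u∈)
      where
      off : ∀ u → remove t I u ≡ false → x u ≡ mix limit u
      off u u∉ with remove-∉ u∉
      ... | inj₁ u∉I = sym (mix-off limit u∉I)
      ... | inj₂ refl = sym (mix-∈ limit (t∈stage K))

    mix-fixed-off-t : SubFixed f (remove t I) (mix limit) (mix limit)
    mix-fixed-off-t = (λ _ _ → refl) , on
      where
      on : ∀ u → remove t I u ≡ true → f (mix limit) u ≡ mix limit u
      on u u∈ with limit u in u∈limit
      ... | true with stage-sound K u u∈limit
      ...   | inj₁ u≡t = ⊥-elim (remove-≢ u∈ u≡t)
      ...   | inj₂ (_ , fS≡x) = fS≡x
      on u u∈ | false = trans (¬-not fS≢x) (sym (complementary u (remove-⊆ u u∈)))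
        where
        fS≢x : f (mix limit) u ≢ x u
        fS≢x fS≡x = false≢true (trans (sym u∈limit) (stable u (trans
          (cong (limit u ∨_) (cong₂ _∧_ (remove-⊆ u u∈) (dec-true (f (mix limit) u Bool.≟ x u) fS≡x)))
          (∨-zeroʳ (limit u)))))

    -- Otherwise mix limit and x would be two different fixed points of the subnetwork on I ∖ {t}.
    covering : I ⊆ limit
    covering w w∈I with limit w in w∈limit
    ... | true = refl
    ... | false = ⊥-elim (x≢y w w∈I (trans
          (smaller-at-most-one (remove t I) (remove-< t∈I) (mix limit) x (mix limit) x-fixed-off-t mix-fixed-off-t
            w (remove-∈ w∈I (λ { refl → false≢true (trans (sym w∈limit) (t∈stage K)) })))
          (mix-∉ limit w∈limit)))

    rank : Fin N → ℕ
    rank u = firstTrue (λ j → stage j u) K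

    rank-≤ : ∀ {u j} → stage j u ≡ true → rank u ≤ j
    rank-≤ {u} {j} u∈ =
      ≮⇒≥ (λ j<rank → false≢true (trans (sym (firstTrue-least (λ j → stage j u) K j j<rank)) u∈))

    ranking : Ranking x t rank
    ranking w w∈I w≢t with rank w | firstTrue-true (λ j → stage j w) K (covering w w∈I)
                                  | firstTrue-least (λ j → stage j w) K
    ... | zero | w∈stage₀ | _ = ⊥-elim (w≢t (dec-true⁻¹ (w Fin.≟ t) w∈stage₀))
    ... | suc j | w∈ | earlier with grow-∈ (stage j) w w∈
    ...   | inj₁ old = ⊥-elim (false≢true (trans (sym (earlier j (n<1+n j))) old))
    ...   | inj₂ (_ , fS≡x) = some-earlier , all-earlier
      where
      S : Subset N
      S = stage j
      some-earlier : x w ≡ false → ∃ λ u → I u ≡ true × Arc f u w × rank u < suc j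
      some-earlier _ with differing-in-neighbour {mix S} {y} {w}
                            (λ fS≡fy → not-¬ refl (trans (sym fS≡x) (trans fS≡fy (f-y≡not-x w w∈I))))
      ... | u , arc , mix≢y with S u in u∈S | I u in u∈I
      ...   | false | _ = ⊥-elim (mix≢y refl)
      ...   | true | false = ⊥-elim (mix≢y (agree-off u u∈I))
      ...   | true | true = u , u∈I , arc , s≤s (rank-≤ u∈S)
      all-earlier : x w ≡ true → ∀ u → I u ≡ true → Arc f u w → rank u < suc j
      all-earlier xw u u∈I arc with S u in u∈S
      ... | true = s≤s (rank-≤ u∈S)
      ... | false = ⊥-elim (false≢true (begin
        false                         ≡⟨ cong not (sym (true⇒literal (trans (proj₂ x-fixed w w∈I) xw) arc)) ⟩
        not (literal arc (x u))       ≡⟨ sym (literal-not arc (x u)) ⟩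
        literal arc (not (x u))       ≡⟨ cong (literal arc) (sym (trans (mix-∉ S u∈S) (complementary u u∈I))) ⟩
        literal arc (mix S u)         ≡⟨ true⇒literal (trans fS≡x xw) arc ⟩
        true                          ∎))
        where open ≡-Reasoning

ChordlessCyclesDelocalized : ∀ {n} → Net n → Set
ChordlessCyclesDelocalized f = ∀ (C : Cycle f) → Chordless C → HasDelocalizing C

PositiveChordlessCyclesDelocalized : ∀ {n} → Net n → Set
PositiveChordlessCyclesDelocalized f = ∀ (C : Cycle f) → Chordless C → PositiveCycle C → HasDelocalizing C

module ComplementaryFixedPoints {N : ℕ} {f : Net N} (andNet : AndNet f) {I : Subset N}
  (smaller-at-most-one : ∀ J → countTrue J < countTrue I → ∀ z → SubAtMostOne f J z)
  {z x y : Config N} (x-fixed : SubFixed f I z x) (y-fixed : SubFixed f I z y)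
  (complementary : ∀ w → I w ≡ true → y w ≡ not (x w)) where
  open AndNetProperties andNet
  open Rankings I (Arc f)

  complementary′ : ∀ w → I w ≡ true → x w ≡ not (y w)
  complementary′ w w∈I = trans (sym (not-involutive (x w))) (cong not (sym (complementary w w∈I)))

  module X = MixedRanking andNet smaller-at-most-one x-fixed y-fixed complementary
  module Y = MixedRanking andNet smaller-at-most-one y-fixed x-fixed complementary′

  predecessor : ∀ v → I v ≡ true → ∃ λ u → I u ≡ true × Arc f u v
  predecessor v v∈I with differing-in-neighbour {x} {y} {v}
    (λ fx≡fy → X.x≢y v v∈I (trans (sym (proj₂ x-fixed v v∈I)) (trans fx≡fy (proj₂ y-fixed v v∈I))))
  ... | u , arc , xu≢yu with I u in u∈I
  ...   | true = u , u∈I , arc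
  ...   | false = ⊥-elim (xu≢yu (X.agree-off u u∈I))

  predecessor-unique : ∀ {v a b} → I v ≡ true → I a ≡ true → I b ≡ true → Arc f a v → Arc f b v → a ≡ b
  predecessor-unique {v} {a} {b} v∈I a∈I b∈I av bv with x v in xv
  ... | false = unique-predecessor complementary v∈I xv a∈I b∈I av bv
                  (X.Stages.ranking v v∈I) (Y.Stages.ranking a a∈I) (Y.Stages.ranking b b∈I)
  ... | true = unique-predecessor complementary′ v∈I (trans (complementary v v∈I) (cong not xv)) a∈I b∈I av bv
                  (Y.Stages.ranking v v∈I) (X.Stages.ranking a a∈I) (X.Stages.ranking b b∈I)

  consistent : ∀ {u w} → I u ≡ true → I w ≡ true → (a : Arc f u w) → literal a (x u) ≡ x w
  consistent {u} {w} u∈I w∈I a with x w in xw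
  ... | true = true⇒literal (trans (proj₂ x-fixed w w∈I) xw) a
  ... | false = not-injective (begin
    not (literal a (x u))     ≡⟨ sym (literal-not a (x u)) ⟩
    literal a (not (x u))     ≡⟨ cong (literal a) (sym (complementary u u∈I)) ⟩
    literal a (y u)           ≡⟨ true⇒literal (trans (X.f-y≡not-x w w∈I) (cong not xw)) a ⟩
    true                      ∎)
    where open ≡-Reasoning

  boundary-satisfies : ∀ {v w} → I v ≡ false → I w ≡ true → (a : Arc f v w) → literal a (z v) ≡ true
  boundary-satisfies {v} {w} v∉I w∈I a with x w in xw
  ... | true = subst (λ b → literal a b ≡ true) (proj₁ x-fixed v v∉I)
                 (true⇒literal (trans (proj₂ x-fixed w w∈I) xw) a)
  ... | false = subst (λ b → literal a b ≡ true) (proj₁ y-fixed v v∉I)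
                  (true⇒literal (trans (X.f-y≡not-x w w∈I) (cong not xw)) a)

  impossible : PositiveChordlessCyclesDelocalized f → NonemptySubset I → ⊥
  impossible delocalized (t , t∈I) =
    no-delocalizing-vertex z boundary-satisfies (delocalized cycle chordless positive)
    where
    open PredecessorCycle {f = f} I predecessor predecessor-unique t∈I
    open CycleArcs andNet cycle
    positive : PositiveCycle cycle
    positive = Equivalence.from (even-countTrue⇔even-parity (neg cycle))
      (consistent⇒even x (λ s → consistent (vertex∈I s) (vertex∈I (next s))))

module _ {N : ℕ} {f : Net N} (andNet : AndNet f) where

  disagreement : Subset N → Config N → Config N → Subset N
  disagreement I x y i = I i ∧ not (does (x i Bool.≟ y i))

  -- If x and y agree somewhere on I, they are two fixed points of the smaller subnetwork on the
  -- set where they disagree; otherwise they are complementary on I.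
  at-most-one-step : PositiveChordlessCyclesDelocalized f →
    ∀ I → (∀ J → countTrue J < countTrue I → ∀ z → SubAtMostOne f J z) → ∀ z → SubAtMostOne f I z
  at-most-one-step delocalized I smaller z x y x-fixed y-fixed i i∈I with x i Bool.≟ y i
  ... | yes xi≡yi = xi≡yi
  ... | no xi≢yi with any? (λ j → (I j Bool.≟ true) Dec.×-dec (x j Bool.≟ y j))
  ...   | no nowhere-equal = ⊥-elim (ComplementaryFixedPoints.impossible andNet smaller x-fixed y-fixed
            (λ w w∈I → ¬-not (λ yw≡xw → nowhere-equal (w , w∈I , sym yw≡xw))) delocalized (i , i∈I))
  ...   | yes (j , j∈I , xj≡yj) = ⊥-elim (xi≢yi (smaller D D<I x x y x-fixed′ y-fixed′ i i∈D))
    where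
    D : Subset N
    D = disagreement I x y
    D⊆I : D ⊆ I
    D⊆I u u∈D with I u
    ... | true = refl
    D<I : countTrue D < countTrue I
    D<I = countTrue-mono-< D⊆I j (cong₂ (λ a b → a ∧ not b) j∈I (dec-true (x j Bool.≟ y j) xj≡yj)) j∈I
    i∈D : D i ≡ true
    i∈D = cong₂ (λ a b → a ∧ not b) i∈I (dec-false (x i Bool.≟ y i) xi≢yi)
    x-fixed′ : SubFixed f D x x
    x-fixed′ = (λ _ _ → refl) , λ u u∈D → proj₂ x-fixed u (D⊆I u u∈D)
    y-fixed′ : SubFixed f D x y
    y-fixed′ = off , λ u u∈D → proj₂ y-fixed u (D⊆I u u∈D)
      where
      off : ∀ u → D u ≡ false → y u ≡ x u
      off u u∉D with I u in u∈I | x u Bool.≟ y u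
      ... | false | _ = trans (proj₁ y-fixed u u∈I) (sym (proj₁ x-fixed u u∈I))
      ... | true | yes xu≡yu = sym xu≡yu

  delocalized⇒at-most-one : PositiveChordlessCyclesDelocalized f →
                            ∀ I z → SubAtMostOne f I z
  delocalized⇒at-most-one delocalized = subset-induction (λ I → ∀ z → SubAtMostOne f I z) (at-most-one-step delocalized)

module NoFixedPoint {N : ℕ} {f : Net N} (andNet : AndNet f) {I : Subset N}
  (smaller-has-fixed-point : ∀ J → countTrue J < countTrue I → ∀ z → ∃ (SubFixed f J z))
  (at-most-one : ∀ J z → SubAtMostOne f J z)
  {z : Config N} (no-fixed-point : ¬ ∃ (SubFixed f I z)) where
  open AndNetProperties andNet

  AlmostFixed : Fin N → Config N → Set
  AlmostFixed t V = (∀ w → I w ≡ false → V w ≡ z w) × (∀ w → I w ≡ true → w ≢ t → f V w ≡ V w)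

  almost-fixed : ∀ {t} → I t ≡ true → ∀ α → ∃ λ V → AlmostFixed t V × V t ≡ α
  almost-fixed {t} t∈I α with smaller-has-fixed-point (remove t I) (Remove.remove-< t I t∈I) (upd z t α)
  ... | V , off , on = V , (off-I , on-I) , trans (off t (Remove.remove-self t I)) (upd-same z t α)
    where
    off-I : ∀ w → I w ≡ false → V w ≡ z w
    off-I w w∉I =
      trans (off w (cong (_∧ _) w∉I)) (upd-other z t α (λ { refl → false≢true (trans (sym w∉I) t∈I) }))
    on-I : ∀ w → I w ≡ true → w ≢ t → f V w ≡ V w
    on-I w w∈I w≢t = on w (Remove.remove-∈ t I w∈I w≢t)

  W : ∀ t → I t ≡ true → Bool → Config N
  W t t∈I α = proj₁ (almost-fixed t∈I α)

  W-almost-fixed : ∀ t t∈I α → AlmostFixed t (W t t∈I α)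
  W-almost-fixed t t∈I α = proj₁ (proj₂ (almost-fixed t∈I α))

  W-at : ∀ t t∈I α → W t t∈I α t ≡ α
  W-at t t∈I α = proj₂ (proj₂ (almost-fixed t∈I α))

  flips : ∀ {t V} → AlmostFixed t V → f V t ≡ not (V t)
  flips {t} {V} (off , on) = ¬-not λ fixed-at-t → no-fixed-point (V , off , on-I fixed-at-t)
    where
    on-I : f V t ≡ V t → ∀ w → I w ≡ true → f V w ≡ V w
    on-I fixed-at-t w w∈I with w Fin.≟ t
    ... | yes refl = fixed-at-t
    ... | no w≢t = on w w∈I w≢t

  -- V and U agree off I ∖ {t, u}, hence everywhere; then V is also fixed at t.
  glue : ∀ {t u V U} → I t ≡ true → t ≢ u → AlmostFixed t V → AlmostFixed u U →
         V t ≡ U t → V u ≡ U u → ⊥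
  glue {t} {u} {V} {U} t∈I t≢u (V-off , V-on) (U-off , U-on) Vt≡Ut Vu≡Uu =
    no-fixed-point (V , V-off , λ w w∈I → V-on-I w w∈I)
    where
    module R₁ = Remove t I
    module R₂ = Remove u (remove t I)
    J : Subset N
    J = remove u (remove t I)
    U≡V-off : ∀ w → J w ≡ false → U w ≡ V w
    U≡V-off w w∉J with R₂.remove-∉ w∉J
    ... | inj₂ refl = sym Vu≡Uu
    ... | inj₁ w∉I′ with R₁.remove-∉ w∉I′
    ...   | inj₂ refl = sym Vt≡Ut
    ...   | inj₁ w∉I = trans (U-off w w∉I) (sym (V-off w w∉I))
    V-fixed-on-J : SubFixed f J V V
    V-fixed-on-J = (λ _ _ → refl) ,
      λ w w∈J → V-on w (R₁.remove-⊆ w (R₂.remove-⊆ w w∈J)) (R₁.remove-≢ (R₂.remove-⊆ w w∈J))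
    U-fixed-on-J : SubFixed f J V U
    U-fixed-on-J = U≡V-off , λ w w∈J → U-on w (R₁.remove-⊆ w (R₂.remove-⊆ w w∈J)) (R₂.remove-≢ w∈J)
    V≗U : ∀ w → V w ≡ U w
    V≗U w with J w in w∈J
    ... | true = at-most-one J V V U V-fixed-on-J U-fixed-on-J w w∈J
    ... | false = sym (U≡V-off w w∈J)
    V-on-I : ∀ w → I w ≡ true → f V w ≡ V w
    V-on-I w w∈I with w Fin.≟ t
    ... | no w≢t = V-on w w∈I w≢t
    ... | yes refl = begin
      f V t    ≡⟨ f-cong V≗U ⟩
      f U t    ≡⟨ U-on t t∈I t≢u ⟩
      U t      ≡⟨ sym Vt≡Ut ⟩
      V t      ∎
      where open ≡-Reasoning

  -- If V u ≡ V′ u, one of V and V′ agrees at t and at u with the almost fixed point at u taking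
  -- the value V u there.
  differ-everywhere : ∀ {t V V′} → I t ≡ true → AlmostFixed t V → AlmostFixed t V′ → V t ≢ V′ t →
                      ∀ u → I u ≡ true → V u ≢ V′ u
  differ-everywhere {t} {V} {V′} t∈I V-almost V′-almost Vt≢V′t u u∈I Vu≡V′u with u Fin.≟ t
  ... | yes refl = Vt≢V′t Vu≡V′u
  ... | no u≢t = glue-with-U (V t Bool.≟ U t)
    where
    U : Config N
    U = W u u∈I (V u)
    glue-with-U : Dec (V t ≡ U t) → ⊥
    glue-with-U (yes Vt≡Ut) = glue t∈I (u≢t ∘ sym) V-almost (W-almost-fixed u u∈I (V u)) Vt≡Ut
                                (sym (W-at u u∈I (V u)))
    glue-with-U (no Vt≢Ut) = glue t∈I (u≢t ∘ sym) V′-almost (W-almost-fixed u u∈I (V u))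
                                (trans (¬-not (Vt≢V′t ∘ sym)) (sym (¬-not (Vt≢Ut ∘ sym))))
                                (trans (sym Vu≡V′u) (sym (W-at u u∈I (V u))))

  W-differ : ∀ t t∈I α u → I u ≡ true → W t t∈I α u ≡ not (W t t∈I (not α) u)
  W-differ t t∈I α u u∈I = ¬-not (differ-everywhere t∈I (W-almost-fixed t t∈I α) (W-almost-fixed t t∈I (not α))
    (λ eq → not-¬ refl (trans (sym (W-at t t∈I α)) (trans eq (W-at t t∈I (not α))))) u u∈I)

  violated⇒false : ∀ {t V i j} → AlmostFixed t V → I i ≡ true → i ≢ t → (a : Arc f j i) →
                   literal a (V j) ≡ false → V i ≡ false
  violated⇒false (_ , on) i∈I i≢t a violated = trans (sym (on _ i∈I i≢t)) (literal-false⇒false a violated)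

  flipped-sets-target : ∀ {p i} (p∈I : I p ≡ true) → I i ≡ true → i ≢ p → (a : Arc f p i) →
                        W p p∈I (not (isNegative a)) i ≡ true
  flipped-sets-target {p} {i} p∈I i∈I i≢p a = trans (W-differ p p∈I (not (isNegative a)) i i∈I) (cong not (begin
    W p p∈I (not (not (isNegative a))) i   ≡⟨ cong (λ α → W p p∈I α i) (not-involutive (isNegative a)) ⟩
    W p p∈I (isNegative a) i               ≡⟨ violated⇒false (W-almost-fixed p p∈I _) i∈I i≢p a
                                               (trans (cong (literal a) (W-at p p∈I _)) (isNegative-violates a)) ⟩
    false                                  ∎))
    where open ≡-Reasoning

  flipped-avoids : ∀ {p q i} (p∈I : I p ≡ true) → I i ≡ true → i ≢ p → (ap : Arc f p i) → (aq : Arc f q i) →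
                   W p p∈I (not (isNegative ap)) q ≡ not (isNegative aq)
  flipped-avoids p∈I i∈I i≢p ap aq = ¬-not λ hits → false≢true (trans
    (sym (violated⇒false (W-almost-fixed _ p∈I _) i∈I i≢p aq (trans (cong (literal aq) hits) (isNegative-violates aq))))
    (flipped-sets-target p∈I i∈I i≢p ap))

  no-two-predecessors : ∀ {p q i} → I p ≡ true → I q ≡ true → I i ≡ true → p ≢ q → i ≢ p → i ≢ q →
                        Arc f p i → Arc f q i → ⊥
  no-two-predecessors {p} {q} p∈I q∈I i∈I p≢q i≢p i≢q ap aq =
    glue p∈I p≢q (W-almost-fixed p p∈I _) (W-almost-fixed q q∈I _)
      (trans (W-at p p∈I _) (sym (flipped-avoids q∈I i∈I i≢q aq ap)))
      (trans (flipped-avoids p∈I i∈I i≢p ap aq) (sym (W-at q q∈I _)))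

  W-true-at : ∀ t t∈I → f (W t t∈I false) t ≡ true
  W-true-at t t∈I = trans (flips (W-almost-fixed t t∈I false)) (cong not (W-at t t∈I false))

  W-false-at : ∀ t t∈I → f (W t t∈I true) t ≡ false
  W-false-at t t∈I = trans (flips (W-almost-fixed t t∈I true)) (cong not (W-at t t∈I true))

  no-loop-and-predecessor : ∀ {q i} → I q ≡ true → I i ≡ true → i ≢ q → Arc f i i → Arc f q i → ⊥
  no-loop-and-predecessor {q} {i} q∈I i∈I i≢q loop aq = false≢true (begin
    false                       ≡⟨ cong not (sym satisfied-by-false) ⟩
    not (literal loop false)    ≡⟨ sym (literal-not loop false) ⟩
    literal loop true           ≡⟨ satisfied-by-true ⟩
    true                        ∎)
    where
    open ≡-Reasoning
    satisfied-by-false : literal loop false ≡ true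
    satisfied-by-false = subst (λ b → literal loop b ≡ true) (W-at i i∈I false) (true⇒literal (W-true-at i i∈I) loop)
    satisfied-by-true : literal loop true ≡ true
    satisfied-by-true = subst (λ b → literal loop b ≡ true) (flipped-sets-target q∈I i∈I i≢q aq)
      (true⇒literal (trans (proj₂ (W-almost-fixed q q∈I _) i i∈I i≢q) (flipped-sets-target q∈I i∈I i≢q aq)) loop)

  predecessor : ∀ t → I t ≡ true → ∃ λ u → I u ≡ true × Arc f u t
  predecessor t t∈I with differing-in-neighbour {W t t∈I false} {W t t∈I true} {t}
                           (λ eq → false≢true (trans (sym (W-false-at t t∈I)) (trans (sym eq) (W-true-at t t∈I))))
  ... | u , a , differ with I u in u∈I
  ...   | true = u , u∈I , a
  ...   | false = ⊥-elim (differ (trans (proj₁ (W-almost-fixed t t∈I false) u u∈I)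
                                        (sym (proj₁ (W-almost-fixed t t∈I true) u u∈I))))

  predecessor-unique : ∀ {v a b} → I v ≡ true → I a ≡ true → I b ≡ true → Arc f a v → Arc f b v → a ≡ b
  predecessor-unique {v} {a} {b} v∈I a∈I b∈I av bv with a Fin.≟ b
  ... | yes a≡b = a≡b
  ... | no a≢b with v Fin.≟ a | v Fin.≟ b
  ...   | yes refl | _ = ⊥-elim (no-loop-and-predecessor b∈I v∈I (a≢b) av bv)
  ...   | no _ | yes refl = ⊥-elim (no-loop-and-predecessor a∈I v∈I (a≢b ∘ sym) bv av)
  ...   | no v≢a | no v≢b = ⊥-elim (no-two-predecessors a∈I b∈I v∈I a≢b v≢a v≢b av bv)

  boundary-satisfies : ∀ {v w} → I v ≡ false → I w ≡ true → (a : Arc f v w) → literal a (z v) ≡ true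
  boundary-satisfies {v} {w} v∉I w∈I a =
    subst (λ b → literal a b ≡ true) (proj₁ (W-almost-fixed w w∈I false) v v∉I)
    (true⇒literal (W-true-at w w∈I) a)

  nonempty : NonemptySubset I
  nonempty with any? (λ i → I i Bool.≟ true)
  ... | yes some = some
  ... | no none = ⊥-elim (no-fixed-point (z , (λ _ _ → refl) , λ i i∈I → ⊥-elim (none (i , i∈I))))

  impossible : ChordlessCyclesDelocalized f → ⊥
  impossible delocalized = no-delocalizing-vertex z boundary-satisfies (delocalized cycle chordless)
    where open PredecessorCycle {f = f} I predecessor predecessor-unique (proj₂ nonempty)

module _ {N : ℕ} {f : Net N} (andNet : AndNet f) where
  open AndNetProperties andNet

  delocalizing? : (C : Cycle f) → Dec (HasDelocalizing C)
  delocalizing? C = any? λ v → any? λ s → any? λ t →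
    Dec.¬? (c C s Fin.≟ c C t) Dec.×-dec posArc? v (c C s) Dec.×-dec negArc? v (c C t)

  fixed-point-step : ChordlessCyclesDelocalized f →
    ∀ I → (∀ J → countTrue J < countTrue I → ∀ z → ∃ (SubFixed f J z)) → ∀ z → ∃ (SubFixed f I z)
  fixed-point-step delocalized I smaller z with fixed-point? I z
  ... | yes fixed = fixed
  ... | no none = ⊥-elim (NoFixedPoint.impossible andNet smaller
                    (delocalized⇒at-most-one andNet (λ C chordless _ → delocalized C chordless)) none delocalized)

  delocalized⇒fixed-point : ChordlessCyclesDelocalized f → ∀ I z → ∃ (SubFixed f I z)
  delocalized⇒fixed-point delocalized =
    subset-induction (λ I → ∀ z → ∃ (SubFixed f I z)) (fixed-point-step delocalized)

  unique⇒delocalized : EverySubUnique f → ChordlessCyclesDelocalized f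
  unique⇒delocalized unique C chordless = Dec.decidable-stable (delocalizing? C) λ not-delocalized →
    let open ChordlessCycleWithoutDelocalizingVertex andNet C chordless not-delocalized
    in not-unique (unique support support-nonempty boundary)

  at-most-one⇒delocalized : EverySubAtMostOne f → PositiveChordlessCyclesDelocalized f
  at-most-one⇒delocalized at-most-one C chordless positive = Dec.decidable-stable (delocalizing? C) λ not-delocalized →
    let open ChordlessCycleWithoutDelocalizingVertex andNet C chordless not-delocalized
    in even⇒two-fixed-points (Equivalence.to (even-countTrue⇔even-parity (neg C)) positive)
                             (at-most-one support support-nonempty boundary)

corollary12 : ∀ (n : ℕ) (f : Net (suc n)) → AndNet f →
    (EverySubUnique f ⇔ (∀ (C : Cycle f) → Chordless C → HasDelocalizing C))
    × (EverySubAtMostOne f ⇔ (∀ (C : Cycle f) → Chordless C → PositiveCycle C → HasDelocalizing C))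
corollary12 n f andNet =
  mk⇔ (unique⇒delocalized andNet)
      (λ delocalized I _ z → delocalized⇒fixed-point andNet delocalized I z ,
                             delocalized⇒at-most-one andNet (λ C chordless _ → delocalized C chordless) I z) ,
  mk⇔ (at-most-one⇒delocalized andNet) (λ delocalized I _ → delocalized⇒at-most-one andNet delocalized I)
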